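{- Let $n>2$ be an integer and $r\ge 1$ an integer with $2^r+1<2^n$. Let $s_i=(2^r+1)2^{n+i}+1$ for $i\in\mathbb{N}$, and let $S=P_{2^r+1}(n)=\langle s_0,s_1,\dots,s_{n+r}\rangle$. If $s\in\mathrm{Ap}(S,s_0)$, then there exists $(a_1,\dots,a_{n+r})\in P(r,n)$ such that $s=a_1s_1+\dots+a_{n+r}s_{n+r}$.
   Context: $\langle\cdot\rangle$ denotes the set of finite non-negative integer linear combinations; $P_{2^r+1}(n)$ is the numerical semigroup generated by $\{(2^r+1)2^{n+i}+1\mid i\in\mathbb{N}\}$, which equals $\langle s_0,\dots,s_{n+r}\rangle$. For a numerical semigroup $S$ and nonzero $m\in S$, the Apéry set is $\mathrm{Ap}(S,m)=\{s\in S\mid s-m\notin S\}$. $P(r,n)$ is the set of all $(n+r)$-tuples $(a_1,\dots,a_{n+r})$ such that $a_i\in\{0,1,2\}$ for every $i$, and if $a_j=2$ for some $j\in\{2,\dots,n+r\}$ then $a_i=0$ for all $i<j$. -}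

module Defs where

open import Data.Nat using (ℕ; zero; suc; _+_; _*_; _^_; _≤_; _<_)
open import Data.Fin using (Fin; toℕ)
open import Data.Vec.Functional using (Vector; foldr)
open import Data.Product using (Σ; _×_)
open import Relation.Binary.PropositionalEquality using (_≡_)
open import Relation.Nullary using (¬_)

∑ : ∀ {k} → (Fin k → ℕ) → ℕ
∑ f = foldr _+_ 0 f

gen : ℕ → ℕ → ℕ → ℕ
gen r n i = (2 ^ r + 1) * 2 ^ (n + i) + 1

InS : ℕ → ℕ → ℕ → Set
InS r n x = Σ (Fin (suc (n + r)) → ℕ) λ c → ∑ (λ i → c i * gen r n (toℕ i)) ≡ x

-- Apéry set Ap(S, m) = { s ∈ S | s - m ∉ S }   (s - m ∉ S, with s - m
-- possibly negative, is rendered as: there is no y ∈ S with y + m = s).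
InApery : ℕ → ℕ → ℕ → ℕ → Set
InApery r n m x = InS r n x × ¬ (Σ ℕ λ y → (y + m ≡ x) × InS r n y)

-- P(r,n): tuples (a_1, …, a_{n+r}) with a_i ∈ {0,1,2}, and if a_j = 2 for
-- some j ∈ {2, …, n+r} then a_i = 0 for all i < j.
-- Index convention: Fin (n+r) position p corresponds to a_{p+1}.
InP : (r n : ℕ) → (Fin (n + r) → ℕ) → Set
InP r n a =
  ((p : Fin (n + r)) → a p ≤ 2) ×
  ((q : Fin (n + r)) → 1 ≤ toℕ q → a q ≡ 2 →
     (p : Fin (n + r)) → toℕ p < toℕ q → a p ≡ 0)

{-# OPTIONS --safe #-}
-- Write s_i = A·2^i + 1 with A = (2^r + 1)·2^n. A combination with coefficient vector c is then
-- A·value c + sum c, where value c = Σ c_i 2^i; so s ∈ Ap(S, s₀) forces c₀ = 0 and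
-- s = A·2Y + K with Y = value t, K = sum t for the tail t. Among vectors of value Y the sums fill
-- the whole interval from the binary digit sum of Y up to Y (trade a 2^(i+1) for two 2^i), and
-- those of the shape of P(r,n) realise exactly digitsum(Y) ≤ K ≤ 1 + digitsum(Y − 1) when
-- Y ≤ 2^(n+r). If K lies above this range, a vector of value 2Y − 1 and sum K − 1 exhibits
-- s − s₀ ∈ S; if Y > 2^(n+r), one of value 2Y − 2 and sum K + A − 1 does.
module Submission where

open import Defs
open import Data.Nat using (ℕ; zero; suc; _+_; _*_; _^_; _≤_; _<_; _≤?_; z≤n; s≤s; z<s; ⌊_/2⌋; ⌈_/2⌉)
open import Data.Nat.Properties
open import Data.Nat.Tactic.RingSolver using (solve-∀)
open import Data.Fin using (Fin; toℕ) renaming (zero to fzero; suc to fsuc)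
open import Data.Vec using (Vec; []; _∷_; lookup; tabulate; sum)
open import Data.Vec.Properties using (lookup∘tabulate)
open import Data.Vec.Relation.Unary.All using (All; []; _∷_)
open import Data.Vec.Relation.Unary.All.Properties using (lookup⁺)
open import Data.Product using (Σ; Σ-syntax; _×_; _,_)
open import Data.Sum using (_⊎_; inj₁; inj₂)
open import Data.Empty using (⊥-elim)
open import Relation.Nullary using (¬_; yes; no)
open import Relation.Binary.PropositionalEquality
open import Function using (_∘′_)
open ≤-Reasoning

value : ∀ {k} → Vec ℕ k → ℕ
value []       = 0
value (x ∷ xs) = x + 2 * value xs

Represents : ∀ k → ℕ → ℕ → Set
Represents k Y K = Σ[ w ∈ Vec ℕ k ] value w ≡ Y × sum w ≡ K

sum≤value : ∀ {k} (v : Vec ℕ k) → sum v ≤ value v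
sum≤value []       = z≤n
sum≤value (x ∷ xs) = +-monoʳ-≤ x (≤-trans (sum≤value xs) (m≤m+n _ _))

m≤n∧m<4n⇒m<2n : ∀ {m n} → m ≤ n → m < 2 * (2 * n) → m < 2 * n
m≤n∧m<4n⇒m<2n {n = zero}  _   m<0 = m<0
m≤n∧m<4n⇒m<2n {n = suc n} m≤n _   = ≤-<-trans m≤n (m<m+n (suc n) z<s)

-- Trading one 2 ^ (i + 1) for two copies of 2 ^ i keeps the value and raises the sum by one.
split : ∀ {k} (v : Vec ℕ k) → sum v < value v → Represents k (value v) (suc (sum v))
split (a ∷ [])        a<a = ⊥-elim (<-irrefl refl a<a)
split (a ∷ suc b ∷ t) _   = 2 + a ∷ b ∷ t , shifted-value a b (value t) , shifted-sum a b (sum t)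
  where
  shifted-value : ∀ a b V → 2 + a + 2 * (b + 2 * V) ≡ a + 2 * (suc b + 2 * V)
  shifted-value = solve-∀
  shifted-sum : ∀ a b S → 2 + a + (b + S) ≡ suc (a + (suc b + S))
  shifted-sum = solve-∀
split (a ∷ 0 ∷ t) lt with split (0 ∷ t) (m≤n∧m<4n⇒m<2n (sum≤value t) (+-cancelˡ-< a _ _ lt))
... | w , value≡ , sum≡ = a ∷ w , cong (λ x → a + 2 * x) value≡ , trans (cong (a +_) sum≡) (+-suc a _)

raise : ∀ {k} (v : Vec ℕ k) {K} → sum v ≤ K → K ≤ value v → Represents k (value v) K
raise v lo hi with m≤n⇒m<n∨m≡n lo
... | inj₂ sum≡K = v , refl , sum≡K
... | inj₁ (s≤s lo′) with raise v lo′ (≤-trans (n≤1+n _) hi)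
...   | w , value≡ , sum≡ with split w (subst₂ _<_ (sym sum≡) (sym value≡) hi)
...     | u , value≡′ , sum≡′ = u , trans value≡′ value≡ , trans sum≡′ (cong suc sum≡)

data EvenOdd : ℕ → Set where
  even : ∀ h → EvenOdd (2 * h)
  odd  : ∀ h → EvenOdd (1 + 2 * h)

2*suc : ∀ h → 2 * suc h ≡ suc (suc (2 * h))
2*suc h = cong suc (+-suc h (h + 0))

evenOdd : ∀ n → EvenOdd n
evenOdd zero          = even 0
evenOdd (suc zero)    = odd 0
evenOdd (suc (suc n)) with evenOdd n
... | even h = subst EvenOdd (2*suc h) (even (suc h))
... | odd h  = subst EvenOdd (cong suc (2*suc h)) (odd (suc h))

lsb : ℕ → ℕ
lsb 0             = 0
lsb 1             = 1
lsb (suc (suc n)) = lsb n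

lsb-even : ∀ h → lsb (2 * h) ≡ 0
lsb-even zero    = refl
lsb-even (suc h) rewrite 2*suc h = lsb-even h

lsb-odd : ∀ h → lsb (1 + 2 * h) ≡ 1
lsb-odd zero    = refl
lsb-odd (suc h) rewrite +-suc h (h + 0) = lsb-odd h

⌊2*h/2⌋≡h : ∀ h → ⌊ 2 * h /2⌋ ≡ h
⌊2*h/2⌋≡h h = sym (trans (n≡⌊n+n/2⌋ h) (cong (λ x → ⌊ h + x /2⌋) (sym (+-identityʳ h))))

⌊1+2*h/2⌋≡h : ∀ h → ⌊ 1 + 2 * h /2⌋ ≡ h
⌊1+2*h/2⌋≡h h = sym (trans (n≡⌈n+n/2⌉ h) (cong (λ x → ⌈ h + x /2⌉) (sym (+-identityʳ h))))

-- The last digit absorbs the overflow, so it may exceed 1.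
binary : ∀ M → ℕ → Vec ℕ (suc M)
binary zero    Y = Y ∷ []
binary (suc M) Y = lsb Y ∷ binary M ⌊ Y /2⌋

binary-even : ∀ M h → binary (suc M) (2 * h) ≡ 0 ∷ binary M h
binary-even M h = cong₂ _∷_ (lsb-even h) (cong (binary M) (⌊2*h/2⌋≡h h))

binary-odd : ∀ M h → binary (suc M) (1 + 2 * h) ≡ 1 ∷ binary M h
binary-odd M h = cong₂ _∷_ (lsb-odd h) (cong (binary M) (⌊1+2*h/2⌋≡h h))

binary-suc-odd : ∀ M h → binary (suc M) (suc (1 + 2 * h)) ≡ 0 ∷ binary M (suc h)
binary-suc-odd M h = trans (cong (binary (suc M)) (sym (2*suc h))) (binary-even M (suc h))

value-binary : ∀ M Y → value (binary M Y) ≡ Y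
value-binary zero    Y = +-identityʳ Y
value-binary (suc M) Y with evenOdd Y
... | even h = trans (cong value (binary-even M h)) (cong (2 *_) (value-binary M h))
... | odd h  = trans (cong value (binary-odd M h)) (cong (λ x → 1 + 2 * x) (value-binary M h))

sum-binary-suc-even : ∀ M h → sum (binary (suc M) (suc (2 * h))) ≡ suc (sum (binary (suc M) (2 * h)))
sum-binary-suc-even M h = begin-equality
  sum (binary (suc M) (1 + 2 * h))    ≡⟨ cong sum (binary-odd M h) ⟩
  suc (sum (binary M h))              ≡⟨ cong (suc ∘′ sum) (binary-even M h) ⟨
  suc (sum (binary (suc M) (2 * h)))  ∎

carry-value : ∀ b h c V → b + 2 * h + 2 * (c + 2 * V) ≡ b + 2 * (h + c + 2 * V)
carry-value = solve-∀

carry-sum : ∀ b h c S → b + (h + c + S) ≤ b + 2 * h + (c + S)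
carry-sum b h c S = ≤-trans (m≤m+n (b + (h + c + S)) h) (≤-reflexive (rearrange b h c S))
  where
  rearrange : ∀ b h c S → b + (h + c + S) + h ≡ b + 2 * h + (c + S)
  rearrange = solve-∀

sum-binary-minimal : ∀ M (v : Vec ℕ (suc M)) → sum (binary M (value v)) ≤ sum v
sum-binary-minimal zero    (a ∷ [])    = ≤-reflexive (+-identityʳ (a + 0))
sum-binary-minimal (suc M) (a ∷ c ∷ t) with evenOdd a
... | even h = begin
  sum (binary (suc M) (2 * h + 2 * (c + 2 * value t)))
    ≡⟨ cong (sum ∘′ binary (suc M)) (carry-value 0 h c (value t)) ⟩
  sum (binary (suc M) (2 * value (h + c ∷ t)))  ≡⟨ cong sum (binary-even M _) ⟩
  sum (binary M (value (h + c ∷ t)))            ≤⟨ sum-binary-minimal M (h + c ∷ t) ⟩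
  h + c + sum t                                 ≤⟨ carry-sum 0 h c (sum t) ⟩
  2 * h + (c + sum t)                           ∎
... | odd h = begin
  sum (binary (suc M) (1 + 2 * h + 2 * (c + 2 * value t)))
    ≡⟨ cong (sum ∘′ binary (suc M)) (carry-value 1 h c (value t)) ⟩
  sum (binary (suc M) (1 + 2 * value (h + c ∷ t)))  ≡⟨ cong sum (binary-odd M _) ⟩
  1 + sum (binary M (value (h + c ∷ t)))            ≤⟨ +-monoʳ-≤ 1 (sum-binary-minimal M (h + c ∷ t)) ⟩
  1 + (h + c + sum t)                               ≤⟨ carry-sum 1 h c (sum t) ⟩
  1 + 2 * h + (c + sum t)                           ∎

sum-binary-pred : ∀ M Z → sum (binary M Z) ≤ sum (binary M (suc Z)) + M
sum-binary-pred zero    Z = ≤-trans (n≤1+n _) (m≤m+n _ 0)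
sum-binary-pred (suc M) Z with evenOdd Z
... | even h = begin
  sum (binary (suc M) (2 * h))                ≤⟨ n≤1+n _ ⟩
  suc (sum (binary (suc M) (2 * h)))          ≡⟨ sum-binary-suc-even M h ⟨
  sum (binary (suc M) (suc (2 * h)))          ≤⟨ m≤m+n _ (suc M) ⟩
  sum (binary (suc M) (suc (2 * h))) + suc M  ∎
... | odd h = begin
  sum (binary (suc M) (1 + 2 * h))    ≡⟨ cong sum (binary-odd M h) ⟩
  1 + sum (binary M h)                ≤⟨ s≤s (sum-binary-pred M h) ⟩
  1 + (sum (binary M (suc h)) + M)    ≡⟨ +-suc _ M ⟨
  sum (binary M (suc h)) + suc M      ≡⟨ cong (λ v → sum v + suc M) (binary-suc-odd M h) ⟨
  sum (binary (suc M) (suc (1 + 2 * h))) + suc M ∎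

double-scale : ∀ q B → q * (2 * B) ≡ 2 * (q * B)
double-scale = solve-∀

excess-step : ∀ b {S q B h} → S + q * B ≤ h + q → q * B ≤ h → b + S + q * (2 * B) ≤ b + 2 * h + q
excess-step b {S} {q} {B} {h} S+qB≤h+q qB≤h = begin
  b + S + q * (2 * B)       ≡⟨ split-scale b S q B ⟩
  b + (S + q * B) + q * B   ≤⟨ +-mono-≤ (+-monoʳ-≤ b S+qB≤h+q) qB≤h ⟩
  b + (h + q) + h           ≡⟨ merge-halves b h q ⟩
  b + 2 * h + q             ∎
  where
  split-scale : ∀ b S q B → b + S + q * (2 * B) ≡ b + (S + q * B) + q * B
  split-scale = solve-∀
  merge-halves : ∀ b h q → b + (h + q) + h ≡ b + 2 * h + q
  merge-halves = solve-∀

sum-binary-excess : ∀ M q {Y} → q * 2 ^ M ≤ Y → sum (binary M Y) + q * 2 ^ M ≤ Y + q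
sum-binary-excess zero    q {Y} _ = ≤-reflexive (cong₂ _+_ (+-identityʳ Y) (*-identityʳ q))
sum-binary-excess (suc M) q {Y} qB≤Y with evenOdd Y
... | even h = begin
  sum (binary (suc M) (2 * h)) + q * 2 ^ suc M
    ≡⟨ cong (λ v → sum v + q * 2 ^ suc M) (binary-even M h) ⟩
  sum (binary M h) + q * 2 ^ suc M  ≤⟨ excess-step 0 (sum-binary-excess M q qB≤h) qB≤h ⟩
  2 * h + q                         ∎
  where
  qB≤h : q * 2 ^ M ≤ h
  qB≤h = *-cancelˡ-≤ 2 (subst (_≤ 2 * h) (double-scale q (2 ^ M)) qB≤Y)
... | odd h = begin
  sum (binary (suc M) (1 + 2 * h)) + q * 2 ^ suc M
    ≡⟨ cong (λ v → sum v + q * 2 ^ suc M) (binary-odd M h) ⟩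
  1 + sum (binary M h) + q * 2 ^ suc M  ≤⟨ excess-step 1 (sum-binary-excess M q qB≤h) qB≤h ⟩
  1 + 2 * h + q                         ∎
  where
  qB≤h : q * 2 ^ M ≤ h
  qB≤h = ≤-pred (*-cancelˡ-< 2 _ (suc h) (begin-strict
    2 * (q * 2 ^ M)   ≡⟨ double-scale q (2 ^ M) ⟨
    q * 2 ^ suc M     ≤⟨ qB≤Y ⟩
    1 + 2 * h         <⟨ n<1+n _ ⟩
    2 + 2 * h         ≡⟨ 2*suc h ⟨
    2 * suc h         ∎))

data Admissible : ∀ {k} → Vec ℕ k → Set where
  []   : Admissible []
  lead : ∀ {k x} {xs : Vec ℕ k} → x ≤ 2 → All (_≤ 1) xs → Admissible (x ∷ xs)
  skip : ∀ {k} {xs : Vec ℕ k} → Admissible xs → Admissible (0 ∷ xs)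

admissible-≤2 : ∀ {k} {a : Vec ℕ k} → Admissible a → ∀ p → lookup a p ≤ 2
admissible-≤2 (lead x≤2 _)  fzero    = x≤2
admissible-≤2 (lead _ bits) (fsuc p) = ≤-trans (lookup⁺ bits p) (n≤1+n 1)
admissible-≤2 (skip _)      fzero    = z≤n
admissible-≤2 (skip adm)    (fsuc p) = admissible-≤2 adm p

admissible-2⇒zeros-before : ∀ {k} {a : Vec ℕ k} → Admissible a →
                            ∀ q → lookup a q ≡ 2 → ∀ p → toℕ p < toℕ q → lookup a p ≡ 0
admissible-2⇒zeros-before _             fzero    _   _        ()
admissible-2⇒zeros-before (lead _ bits) (fsuc q) a≡2 _        _ =
  ⊥-elim (<⇒≱ (n<1+n 1) (subst (_≤ 1) a≡2 (lookup⁺ bits q)))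
admissible-2⇒zeros-before (skip _)      (fsuc q) _   fzero    _ = refl
admissible-2⇒zeros-before (skip adm)    (fsuc q) a≡2 (fsuc p) (s≤s p<q) =
  admissible-2⇒zeros-before adm q a≡2 p p<q

binary-bits : ∀ M {Y} → Y < 2 ^ suc M → All (_≤ 1) (binary M Y)
binary-bits zero    Y<2 = ≤-pred Y<2 ∷ []
binary-bits (suc M) {Y} Y<2B with evenOdd Y
... | even h = subst (All (_≤ 1)) (sym (binary-even M h))
                 (z≤n ∷ binary-bits M (*-cancelˡ-< 2 h _ Y<2B))
... | odd h  = subst (All (_≤ 1)) (sym (binary-odd M h))
                 (s≤s z≤n ∷ binary-bits M (*-cancelˡ-< 2 h _ (≤-trans (n≤1+n _) Y<2B)))

binary-admissible : ∀ M {Y} → Y ≤ 2 ^ suc M → Admissible (binary M Y)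
binary-admissible zero    Y≤2 = lead Y≤2 []
binary-admissible (suc M) {Y} Y≤2B with evenOdd Y
... | even h = subst Admissible (sym (binary-even M h))
                 (skip (binary-admissible M (*-cancelˡ-≤ 2 Y≤2B)))
... | odd h  = subst Admissible (sym (binary-odd M h))
                 (lead (s≤s z≤n) (binary-bits M (*-cancelˡ-< 2 h _ Y≤2B)))

AdmissibleRep : ∀ M → ℕ → ℕ → Set
AdmissibleRep M Y K = Σ[ a ∈ Vec ℕ (suc M) ] Admissible a × value a ≡ Y × sum a ≡ K

binary-rep : ∀ M {Y K} → Y ≤ 2 ^ suc M → sum (binary M Y) ≡ K → AdmissibleRep M Y K
binary-rep M {Y} Y≤ sum≡K = binary M Y , binary-admissible M Y≤ , value-binary M Y , sum≡K

admissible-range : ∀ M {Z K} → suc Z ≤ 2 ^ suc M →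
                   sum (binary M (suc Z)) ≤ K → K ≤ suc (sum (binary M Z)) → AdmissibleRep M (suc Z) K
admissible-range zero    {Z} Y≤2 lo hi = suc Z ∷ [] , lead Y≤2 [] , +-identityʳ (suc Z) , ≤-antisym lo hi
admissible-range (suc M) {Z} {K} Y≤ lo hi with evenOdd Z
... | even h = binary-rep (suc M) Y≤ (≤-antisym lo (subst (K ≤_) (sym (sum-binary-suc-even M h)) hi))
... | odd h  = two-or-deeper (m≤n⇒m<n∨m≡n (subst (λ v → K ≤ suc (sum v)) (binary-odd M h) hi))
  where
  h<B : h < 2 ^ suc M
  h<B = *-cancelˡ-≤ 2 (subst (_≤ 2 ^ suc (suc M)) (sym (2*suc h)) Y≤)
  two-or-deeper : K < 2 + sum (binary M h) ⊎ K ≡ 2 + sum (binary M h) →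
                  AdmissibleRep (suc M) (suc (1 + 2 * h)) K
  two-or-deeper (inj₂ K≡) =
    2 ∷ binary M h , lead ≤-refl (binary-bits M h<B) , cong (λ x → 2 + 2 * x) (value-binary M h) , sym K≡
  two-or-deeper (inj₁ (s≤s K≤))
    with admissible-range M h<B (subst (λ v → sum v ≤ K) (binary-suc-odd M h) lo) K≤
  ... | a , adm , value≡ , sum≡ = 0 ∷ a , skip adm , trans (cong (2 *_) value≡) (2*suc h) , sum≡

-- A * value w + sum w is the element of S with coefficients w, and A + 1 = s₀.
Collision : ∀ M → ℕ → ℕ → ℕ → Set
Collision M A Y K = Σ[ w ∈ Vec ℕ (suc (suc M)) ] A * value w + sum w + (A + 1) ≡ A * (2 * Y) + K

odd-collision : ∀ M A {Z K} → suc (sum (binary M Z)) < K → K ≤ suc Z → Collision M A (suc Z) K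
odd-collision M A {Z} {suc K} (s≤s S<K) (s≤s K≤Z) with raise (1 ∷ binary M Z) S<K (begin
    K                        ≤⟨ K≤Z ⟩
    Z                        ≤⟨ m≤m+n Z (Z + 0) ⟩
    2 * Z                    ≤⟨ n≤1+n _ ⟩
    1 + 2 * Z                ≡⟨ cong (λ V → 1 + 2 * V) (value-binary M Z) ⟨
    value (1 ∷ binary M Z)   ∎)
... | w , value≡ , sum≡ = w , (begin-equality
    A * value w + sum w + (A + 1)
      ≡⟨ cong₂ (λ V S → A * V + S + (A + 1))
               (trans value≡ (cong (λ V → 1 + 2 * V) (value-binary M Z))) sum≡ ⟩
    A * (1 + 2 * Z) + K + (A + 1)   ≡⟨ collision-odd A Z K ⟩
    A * (2 * suc Z) + suc K         ∎)
  where
  collision-odd : ∀ A Z K → A * (1 + 2 * Z) + K + (A + 1) ≡ A * (2 * suc Z) + suc K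
  collision-odd = solve-∀

room-even : ∀ M {A Z K} → suc A + 2 ≤ 2 ^ suc (suc M) → 2 ^ suc M ≤ Z → K ≤ suc (sum (binary M Z)) →
            K + A ≤ 2 * Z
room-even M {A} {Z} {K} A≤ B≤Z K≤ = +-cancelʳ-≤ (2 ^ suc M) (K + A) (2 * Z) (begin
  K + A + 2 * B              ≡⟨ swap K A (2 * B) ⟩
  K + 2 * B + A              ≤⟨ +-monoˡ-≤ A (+-monoˡ-≤ (2 * B) K≤) ⟩
  suc (S + 2 * B) + A        ≤⟨ +-monoˡ-≤ A (s≤s (sum-binary-excess M 2 B≤Z)) ⟩
  suc (Z + 2) + A            ≡⟨ regroup Z A ⟩
  Z + (suc A + 2)            ≤⟨ +-monoʳ-≤ Z A≤ ⟩
  Z + 2 * (2 * B)            ≡⟨ double-twice Z B ⟩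
  Z + 2 * B + 2 * B          ≤⟨ +-monoˡ-≤ (2 * B) (+-monoʳ-≤ Z B≤Z) ⟩
  Z + Z + 2 * B              ≡⟨ cong (λ x → Z + x + 2 * B) (+-identityʳ Z) ⟨
  2 * Z + 2 * B              ∎)
  where
  B = 2 ^ M
  S = sum (binary M Z)
  swap : ∀ K A C → K + A + C ≡ K + C + A
  swap = solve-∀
  regroup : ∀ Z A → suc (Z + 2) + A ≡ Z + (suc A + 2)
  regroup = solve-∀
  double-twice : ∀ Z B → Z + 2 * (2 * B) ≡ Z + 2 * B + 2 * B
  double-twice = solve-∀

even-collision : ∀ M A {Z K} → M ≤ A → suc A + 2 ≤ 2 ^ suc (suc M) → 2 ^ suc M ≤ Z →
                 sum (binary M (suc Z)) ≤ K → K ≤ suc (sum (binary M Z)) → Collision M (suc A) (suc Z) K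
even-collision M A {Z} {K} M≤A A≤ B≤Z lo hi with raise (0 ∷ binary M Z) {K + A}
    (≤-trans (sum-binary-pred M Z) (+-mono-≤ lo M≤A))
    (subst (K + A ≤_) (cong (2 *_) (sym (value-binary M Z))) (room-even M A≤ B≤Z hi))
... | w , value≡ , sum≡ = w , (begin-equality
    suc A * value w + sum w + (suc A + 1)
      ≡⟨ cong₂ (λ V S → suc A * V + S + (suc A + 1)) (trans value≡ (cong (2 *_) (value-binary M Z))) sum≡ ⟩
    suc A * (2 * Z) + (K + A) + (suc A + 1)   ≡⟨ collision-even A Z K ⟩
    suc A * (2 * suc Z) + K                   ∎)
  where
  collision-even : ∀ A Z K → suc A * (2 * Z) + (K + A) + (suc A + 1) ≡ suc A * (2 * suc Z) + K
  collision-even = solve-∀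

admissible-representation : ∀ M A → M < A → A + 2 ≤ 2 ^ suc (suc M) → ∀ {Y K} →
                            sum (binary M Y) ≤ K → K ≤ Y → ¬ Collision M A Y K → AdmissibleRep M Y K
admissible-representation M A _ _ {zero} lo hi _ = binary-rep M z≤n (≤-antisym lo (≤-trans hi z≤n))
admissible-representation M (suc A) (s≤s M≤A) A≤ {suc Z} {K} lo hi no-collision
  with K ≤? suc (sum (binary M Z)) | suc Z ≤? 2 ^ suc M
... | yes K≤ | yes Y≤ = admissible-range M Y≤ lo K≤
... | no K≰  | _      = ⊥-elim (no-collision (odd-collision M (suc A) (≰⇒> K≰) hi))
... | yes K≤ | no Y≰  = ⊥-elim (no-collision (even-collision M A M≤A A≤ (≤-pred (≰⇒> Y≰)) lo K≤))

∑-cong : ∀ {k} {f g : Fin k → ℕ} → (∀ i → f i ≡ g i) → ∑ f ≡ ∑ g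
∑-cong {zero}  _   = refl
∑-cong {suc k} f≗g = cong₂ _+_ (f≗g fzero) (∑-cong (λ i → f≗g (fsuc i)))

∑-weighted : ∀ B {k} (v : Vec ℕ k) → ∑ (λ i → lookup v i * (B * 2 ^ toℕ i + 1)) ≡ B * value v + sum v
∑-weighted B []      = sym (cong (_+ 0) (*-zeroʳ B))
∑-weighted B (x ∷ v) = begin-equality
  x * (B * 1 + 1) + ∑ (λ i → lookup v i * (B * (2 * 2 ^ toℕ i) + 1))
    ≡⟨ cong (x * (B * 1 + 1) +_)
            (∑-cong λ i → cong (λ c → lookup v i * (c + 1)) (*-assoc B 2 (2 ^ toℕ i))) ⟨
  x * (B * 1 + 1) + ∑ (λ i → lookup v i * (B * 2 * 2 ^ toℕ i + 1))
    ≡⟨ cong (x * (B * 1 + 1) +_) (∑-weighted (B * 2) v) ⟩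
  x * (B * 1 + 1) + (B * 2 * value v + sum v)
    ≡⟨ regroup B x (value v) (sum v) ⟩
  B * (x + 2 * value v) + (x + sum v) ∎
  where
  regroup : ∀ B x V S → x * (B * 1 + 1) + (B * 2 * V + S) ≡ B * (x + 2 * V) + (x + S)
  regroup = solve-∀

multiplier : ℕ → ℕ → ℕ
multiplier r n = (2 ^ r + 1) * 2 ^ n

gen≡ : ∀ r n i → gen r n i ≡ multiplier r n * 2 ^ i + 1
gen≡ r n i = cong (_+ 1) (begin-equality
  (2 ^ r + 1) * 2 ^ (n + i)        ≡⟨ cong ((2 ^ r + 1) *_) (^-distribˡ-+-* 2 n i) ⟩
  (2 ^ r + 1) * (2 ^ n * 2 ^ i)    ≡⟨ *-assoc (2 ^ r + 1) (2 ^ n) (2 ^ i) ⟨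
  (2 ^ r + 1) * 2 ^ n * 2 ^ i      ∎)

gen₀≡ : ∀ r n → gen r n 0 ≡ multiplier r n + 1
gen₀≡ r n = trans (gen≡ r n 0) (cong (_+ 1) (*-identityʳ (multiplier r n)))

∑-gen : ∀ r n {k} (v : Vec ℕ k) →
        ∑ (λ i → lookup v i * gen r n (toℕ i)) ≡ multiplier r n * value v + sum v
∑-gen r n v = trans (∑-cong λ i → cong (lookup v i *_) (gen≡ r n (toℕ i))) (∑-weighted (multiplier r n) v)

∑-gen-suc : ∀ r n {k} (v : Vec ℕ k) →
            ∑ (λ i → lookup v i * gen r n (suc (toℕ i))) ≡ multiplier r n * (2 * value v) + sum v
∑-gen-suc r n v = begin-equality
  ∑ (λ i → lookup v i * gen r n (suc (toℕ i)))
    ≡⟨ ∑-cong (λ i → cong (lookup v i *_)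
                  (trans (gen≡ r n (suc (toℕ i))) (cong (_+ 1) (sym (*-assoc A 2 _))))) ⟩
  ∑ (λ i → lookup v i * (A * 2 * 2 ^ toℕ i + 1))  ≡⟨ ∑-weighted (A * 2) v ⟩
  A * 2 * value v + sum v                          ≡⟨ cong (_+ sum v) (*-assoc A 2 (value v)) ⟩
  A * (2 * value v) + sum v                        ∎
  where A = multiplier r n

InS-intro : ∀ r n (w : Vec ℕ (suc (n + r))) → InS r n (multiplier r n * value w + sum w)
InS-intro r n w = lookup w , ∑-gen r n w

InS-elim : ∀ r n {s} → InS r n s → Σ[ w ∈ Vec ℕ (suc (n + r)) ] multiplier r n * value w + sum w ≡ s
InS-elim r n (c , c≡s) = tabulate c , (begin-equality
  multiplier r n * value (tabulate c) + sum (tabulate c)  ≡⟨ ∑-gen r n (tabulate c) ⟨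
  ∑ (λ i → lookup (tabulate c) i * gen r n (toℕ i))
    ≡⟨ ∑-cong (λ i → cong (_* gen r n (toℕ i)) (lookup∘tabulate c i)) ⟩
  ∑ (λ i → c i * gen r n (toℕ i))                         ≡⟨ c≡s ⟩
  _                                                       ∎)

admissible⇒InP : ∀ r n {a : Vec ℕ (n + r)} → Admissible a → InP r n (lookup a)
admissible⇒InP r n adm = admissible-≤2 adm , λ q _ → admissible-2⇒zeros-before adm q

s₀-peels-off : ∀ r n z (t : Vec ℕ (n + r)) →
               Σ ℕ λ y → (y + gen r n 0 ≡ multiplier r n * value (suc z ∷ t) + sum (suc z ∷ t)) × InS r n y
s₀-peels-off r n z t = A * value (z ∷ t) + sum (z ∷ t) ,
  trans (cong (A * value (z ∷ t) + sum (z ∷ t) +_) (gen₀≡ r n)) (peel A z (value t) (sum t)) ,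
  InS-intro r n (z ∷ t)
  where
  A = multiplier r n
  peel : ∀ A z V S → A * (z + 2 * V) + (z + S) + (A + 1) ≡ A * (suc z + 2 * V) + (suc z + S)
  peel = solve-∀

collision⇒s₀-peels-off : ∀ r n {Y K} → Collision (n + r) (multiplier r (suc n)) Y K →
  Σ ℕ λ y → (y + gen r (suc n) 0 ≡ multiplier r (suc n) * (2 * Y) + K) × InS r (suc n) y
collision⇒s₀-peels-off r n (w , eq) =
  A * value w + sum w , trans (cong (A * value w + sum w +_) (gen₀≡ r (suc n))) eq , InS-intro r (suc n) w
  where A = multiplier r (suc n)

n<2^n : ∀ n → n < 2 ^ n
n<2^n zero    = z<s
n<2^n (suc n) = subst (_≤ 2 ^ suc n) (+-comm (suc n) 1) (+-mono-≤ (n<2^n n) (≤-trans (m^n>0 2 n) (m≤m+n _ 0)))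

multiplier≡ : ∀ r n → multiplier r n ≡ 2 ^ (n + r) + 2 ^ n
multiplier≡ r n = begin-equality
  (2 ^ r + 1) * 2 ^ n        ≡⟨ *-distribʳ-+ (2 ^ n) (2 ^ r) 1 ⟩
  2 ^ r * 2 ^ n + 1 * 2 ^ n  ≡⟨ cong₂ _+_ (sym (^-distribˡ-+-* 2 r n)) (*-identityˡ (2 ^ n)) ⟩
  2 ^ (r + n) + 2 ^ n        ≡⟨ cong (λ e → 2 ^ e + 2 ^ n) (+-comm r n) ⟩
  2 ^ (n + r) + 2 ^ n        ∎

n+r≤multiplier : ∀ r n → n + r ≤ multiplier r n
n+r≤multiplier r n = begin
  n + r                ≤⟨ <⇒≤ (n<2^n (n + r)) ⟩
  2 ^ (n + r)          ≤⟨ m≤m+n _ (2 ^ n) ⟩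
  2 ^ (n + r) + 2 ^ n  ≡⟨ multiplier≡ r n ⟨
  multiplier r n       ∎

multiplier+2≤ : ∀ r n → 1 ≤ n → 1 ≤ r → multiplier r n + 2 ≤ 2 ^ suc (n + r)
multiplier+2≤ r n 1≤n 1≤r = begin
  multiplier r n + 2             ≡⟨ cong (_+ 2) (multiplier≡ r n) ⟩
  2 ^ (n + r) + 2 ^ n + 2        ≡⟨ +-assoc (2 ^ (n + r)) (2 ^ n) 2 ⟩
  2 ^ (n + r) + (2 ^ n + 2)      ≤⟨ +-monoʳ-≤ (2 ^ (n + r)) (+-monoʳ-≤ (2 ^ n) (^-monoʳ-≤ 2 1≤n)) ⟩
  2 ^ (n + r) + (2 ^ n + 2 ^ n)  ≡⟨ cong (λ x → 2 ^ (n + r) + (2 ^ n + x)) (+-identityʳ (2 ^ n)) ⟨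
  2 ^ (n + r) + 2 ^ suc n        ≤⟨ +-monoʳ-≤ (2 ^ (n + r)) (^-monoʳ-≤ 2 suc-n≤n+r) ⟩
  2 ^ (n + r) + 2 ^ (n + r)      ≡⟨ cong (2 ^ (n + r) +_) (+-identityʳ (2 ^ (n + r))) ⟨
  2 ^ suc (n + r)                ∎
  where
  suc-n≤n+r : suc n ≤ n + r
  suc-n≤n+r = subst (_≤ n + r) (+-comm n 1) (+-monoʳ-≤ n 1≤r)

lemma7 : (n r : ℕ) → 2 < n → 1 ≤ r → 2 ^ r + 1 < 2 ^ n →
    (s : ℕ) → InApery r n (gen r n 0) s →
    Σ (Fin (n + r) → ℕ) λ a →
      InP r n a × (s ≡ ∑ (λ p → a p * gen r n (suc (toℕ p))))
lemma7 zero    r () _ _ _ _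
lemma7 (suc n) r _ 1≤r _ _ (s∈S , s-s₀∉S) with InS-elim r (suc n) s∈S
... | suc z ∷ t , refl = ⊥-elim (s-s₀∉S (s₀-peels-off r (suc n) z t))
... | 0 ∷ t , refl
  with admissible-representation (n + r) (multiplier r (suc n))
         (n+r≤multiplier r (suc n)) (multiplier+2≤ r (suc n) (s≤s z≤n) 1≤r)
         (sum-binary-minimal _ t) (sum≤value t) (s-s₀∉S ∘′ collision⇒s₀-peels-off r n {value t})
...   | a , adm , value≡ , sum≡ = lookup a , admissible⇒InP r (suc n) adm , (begin-equality
  multiplier r (suc n) * (2 * value t) + sum t
    ≡⟨ cong₂ (λ V K → multiplier r (suc n) * (2 * V) + K) value≡ sum≡ ⟨
  multiplier r (suc n) * (2 * value a) + sum a        ≡⟨ ∑-gen-suc r (suc n) a ⟨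
  ∑ (λ p → lookup a p * gen r (suc n) (suc (toℕ p)))  ∎)
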